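{- Let $\mathcal{F} \subset \mathcal{P}([n])$ be an $r$-closed $\theta$-intersecting family, where $r \geq 3$ and $\theta \in (0,1)$. Let $A \in \mathcal{F}_{\mathrm{nor}}$. If there exists $B \in \mathcal{F}(i_{\max})$ such that $\mathrm{petal}(A) \cap \mathrm{core}(B) \neq \emptyset$, then $\mathrm{core}(B) \subseteq A$. Moreover, there is at most one set $A \in \mathcal{F}_{\mathrm{nor}}$ for which such a $B$ exists.
   Context: A family $\mathcal{F} \subset \mathcal{P}([n])$ is $r$-closed $\theta$-intersecting if for each $2 \leq t \leq r$ and any $t$ distinct sets $A_1,\dots,A_t \in \mathcal{F}$ we have $|A_1 \cap \dots \cap A_t| \in \{\theta|A_1|, \dots, \theta|A_t|\}$. $\mathcal{F}(i) := \mathcal{F} \cap \binom{[n]}{i}$. For $A \in \mathcal{F}$, $\mathrm{Tor}(A) := \{B \in \mathcal{F} : |B| \geq |A|,\ |A \cap B| = \theta|A|\}$. When $\mathrm{Tor}(A) \neq \emptyset$, $\mathrm{core}(A) := A \cap B$ for any $B \in \mathrm{Tor}(A)$ (independent of the choice of $B$), and $\mathrm{petal}(A) := A \setminus \mathrm{core}(A)$. $S := \{i \in [n] : \mathcal{F}(i) \neq \emptyset\}$, $S_{\mathrm{nor}} := \{i \in S : \mathrm{Tor}(A) \neq \emptyset \text{ for all } A \in \mathcal{F}(i)\}$, $i_{\max} := \max S_{\mathrm{nor}}$, and $\mathcal{F}_{\mathrm{nor}} := \bigcup_{i \in S_{\mathrm{nor}}} \mathcal{F}(i)$. -}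

module Defs where

open import Data.Nat using (ℕ; _*_; _≤_; _<_)
open import Data.Fin using (Fin)
open import Data.Fin.Subset using (Subset; _∩_; _─_; ⋂; ∣_∣; Nonempty; _⊆_)
open import Data.List using (tabulate)
open import Data.Product using (Σ; ∃; ∃-syntax; _×_; _,_)
open import Relation.Binary.PropositionalEquality using (_≡_)
open import Function.Definitions using (Injective)

-- θ is represented as the fraction p / q (with 0 < p < q assumed in the theorem).
-- "x = θ·y" is encoded as q * x ≡ p * y.
_≐θ[_/_]·_ : ℕ → ℕ → ℕ → ℕ → Set
x ≐θ[ p / q ]· y = q * x ≡ p * y

Family : ℕ → Set₁
Family n = Subset n → Set

RClosedThetaIntersecting : ∀ {n} → ℕ → ℕ → ℕ → Family n → Set
RClosedThetaIntersecting {n} r p q F =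
  ∀ (t : ℕ) → 2 ≤ t → t ≤ r →
  ∀ (As : Fin t → Subset n) → Injective _≡_ _≡_ As → (∀ j → F (As j)) →
  ∃[ j ] (∣ ⋂ (tabulate As) ∣ ≐θ[ p / q ]· ∣ As j ∣)

InTor : ∀ {n} → ℕ → ℕ → Family n → Subset n → Subset n → Set
InTor p q F A B = F B × ∣ A ∣ ≤ ∣ B ∣ × (∣ A ∩ B ∣ ≐θ[ p / q ]· ∣ A ∣)

TorNonempty : ∀ {n} → ℕ → ℕ → Family n → Subset n → Set
TorNonempty p q F A = ∃[ B ] InTor p q F A B

InSnor : ∀ {n} → ℕ → ℕ → Family n → ℕ → Set
InSnor {n} p q F i =
  (∃[ A ] (F A × ∣ A ∣ ≡ i)) ×
  (∀ (A : Subset n) → F A → ∣ A ∣ ≡ i → TorNonempty p q F A)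

InFnor : ∀ {n} → ℕ → ℕ → Family n → Subset n → Set
InFnor p q F A = F A × InSnor p q F ∣ A ∣

IsImax : ∀ {n} → ℕ → ℕ → Family n → ℕ → Set
IsImax p q F i = InSnor p q F i × (∀ j → InSnor p q F j → j ≤ i)

InFimax : ∀ {n} → ℕ → ℕ → Family n → Subset n → Set
InFimax p q F B = F B × IsImax p q F ∣ B ∣

-- core(A) = A ∩ T for T ∈ Tor(A); petal(A) = A ∖ core(A)
core : ∀ {n} → Subset n → Subset n → Subset n
core A T = A ∩ T

petal : ∀ {n} → Subset n → Subset n → Subset n
petal A T = A ─ core A T

HasPetalHit : ∀ {n} → ℕ → ℕ → Family n → Subset n → Set
HasPetalHit p q F A =
  ∃[ B ] (InFimax p q F B × ∃[ TA ] ∃[ TB ]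
    (InTor p q F A TA × InTor p q F B TB × Nonempty (petal A TA ∩ core B TB)))

-- Everything rests on one consequence of 3-closedness: the core D ∩ T of D (T ∈ Tor(D))
-- lies in every G ∈ F with |G| ≥ |D|, since |D ∩ T ∩ G| is θ times one of |D|, |T|, |G|
-- and hence at least θ|D| = |D ∩ T|.
-- Let x ∈ petal(A) ∩ core(B) with B ∈ F(i_max) and T ∈ Tor(B). Then |A ∩ B ∩ T| is θ times
-- one of |A|, |B|, |T|. In the last two cases it is at least |core(B)|, so core(B) ⊆ A.
-- In the first, core(A) ⊆ B ∩ T, so A ∩ core(B) contains core(A) and has its size; it
-- would then equal core(A), which misses x. The same fact gives |A| < |B|, as otherwise x
-- would lie in the core of A taken with respect to B or to T.
-- For uniqueness, all sets of F(i_max) share one core, which then lies in A₁ ∩ A₂;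
-- but |A₁ ∩ A₂| = θ|Aⱼ| < θ|B| = |core(B)|.
module Submission where

open import Defs
open import Data.Nat using (ℕ; zero; suc; _≤_; _<_; _*_; z≤n; s≤s; >-nonZero)
open import Data.Nat.Properties
open import Data.Fin using (Fin; zero; suc)
open import Data.Fin.Subset using (Subset; _∩_; _─_; _⊆_; _∈_; _∉_; Nonempty; ∣_∣; inside; outside)
open import Data.Fin.Subset.Properties
  using (p∩q⊆p; p∩q⊆q; ∩-assoc; ∩-comm; ∩-idem; ∩-identityʳ; x∈p∩q⁺; x∈p∩q⁻;
         ∣p∩q∣≤∣p∣; p⊆q⇒∣p∣≤∣q∣; x∈p⇒∣p-x∣<∣p∣)
open import Data.Vec using (_∷_; here; there)
open import Data.Vec.Properties using (≡-dec)
open import Data.Bool.Properties using () renaming (_≟_ to _≟ᵇ_)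
open import Data.Product using (_×_; _,_; proj₁; proj₂)
open import Data.Sum using (_⊎_; inj₁; inj₂)
open import Relation.Nullary using (¬_; Dec; yes; no; contradiction)
open import Relation.Binary.PropositionalEquality
  using (_≡_; _≢_; refl; sym; trans; cong; subst; ≢-sym)

_≟ₛ_ : ∀ {n} (X Y : Subset n) → Dec (X ≡ Y)
_≟ₛ_ = ≡-dec _≟ᵇ_

x∈p─q⁻ : ∀ {n} (p q : Subset n) {x} → x ∈ p ─ q → x ∈ p × x ∉ q
x∈p─q⁻ (inside ∷ p) (outside ∷ q) {zero} here = here , λ ()
x∈p─q⁻ (inside ∷ p) (inside ∷ q) {zero} ()
x∈p─q⁻ (outside ∷ p) (inside ∷ q) {zero} ()
x∈p─q⁻ (outside ∷ p) (outside ∷ q) {zero} ()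
x∈p─q⁻ (_ ∷ p) (_ ∷ q) {suc x} (there x∈p─q) with x∈p─q⁻ p q x∈p─q
... | x∈p , x∉q = there x∈p , λ { (there x∈q) → x∉q x∈q }

∣p∣≤∣p∩q∣⇒p⊆q : ∀ {n} (p q : Subset n) → ∣ p ∣ ≤ ∣ p ∩ q ∣ → p ⊆ q
∣p∣≤∣p∩q∣⇒p⊆q (inside ∷ p) (inside ∷ q) _ here = here
∣p∣≤∣p∩q∣⇒p⊆q (inside ∷ p) (inside ∷ q) (s≤s le) (there x∈p) = there (∣p∣≤∣p∩q∣⇒p⊆q p q le x∈p)
∣p∣≤∣p∩q∣⇒p⊆q (inside ∷ p) (outside ∷ q) le _ =
  contradiction (≤-trans le (∣p∩q∣≤∣p∣ p q)) (<-irrefl refl)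
∣p∣≤∣p∩q∣⇒p⊆q (outside ∷ p) (_ ∷ q) le (there x∈p) = there (∣p∣≤∣p∩q∣⇒p⊆q p q le x∈p)

x∈petal⁻ : ∀ {n} (A T : Subset n) {x} → x ∈ petal A T → x ∈ A × x ∉ T
x∈petal⁻ A T x∈petal with x∈p─q⁻ A (A ∩ T) x∈petal
... | x∈A , x∉core = x∈A , λ x∈T → x∉core (x∈p∩q⁺ (x∈A , x∈T))

module Ratio (p q : ℕ) where

  ≐θ-mono : ∀ {a c d d'} → 0 < q →
    a ≐θ[ p / q ]· d → d ≤ d' → c ≐θ[ p / q ]· d' → a ≤ c
  ≐θ-mono 0<q qa≡pd d≤d' qc≡pd' = *-cancelˡ-≤ q {{>-nonZero 0<q}}
    (≤-trans (≤-reflexive qa≡pd) (≤-trans (*-monoʳ-≤ p d≤d') (≤-reflexive (sym qc≡pd'))))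

  ≐θ-strictMono : ∀ {a c d d'} → 0 < p →
    a ≐θ[ p / q ]· d → d < d' → c ≐θ[ p / q ]· d' → a < c
  ≐θ-strictMono 0<p qa≡pd d<d' qc≡pd' = *-cancelˡ-< q _ _
    (≤-trans (s≤s (≤-reflexive qa≡pd))
      (≤-trans (*-monoʳ-< p {{>-nonZero 0<p}} d<d') (≤-reflexive (sym qc≡pd'))))

module TorBasics {n : ℕ} (p q : ℕ) (F : Family n) where

  InTor⇒≢ : ∀ {B T : Subset n} → p < q → Nonempty B → InTor p q F B T → B ≢ T
  InTor⇒≢ {B} p<q (x , x∈B) (_ , _ , θ∣B∩B∣) refl =
    <⇒≱ p<q (*-cancelʳ-≤ q p ∣ B ∣ {{>-nonZero 0<∣B∣}} (≤-reflexive q∣B∣≡p∣B∣))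
    where
    0<∣B∣ : 0 < ∣ B ∣
    0<∣B∣ = ≤-trans (s≤s z≤n) (x∈p⇒∣p-x∣<∣p∣ x∈B)
    q∣B∣≡p∣B∣ : q * ∣ B ∣ ≡ p * ∣ B ∣
    q∣B∣≡p∣B∣ = subst (λ Z → q * ∣ Z ∣ ≡ p * ∣ B ∣) (∩-idem B) θ∣B∩B∣

  IsImax-unique : ∀ {i j : ℕ} → IsImax p q F i → IsImax p q F j → i ≡ j
  IsImax-unique (i∈S , i-max) (j∈S , j-max) = ≤-antisym (j-max _ i∈S) (i-max _ j∈S)

  ∣Fnor∣≤∣Fimax∣ : ∀ {A B : Subset n} →
    InFnor p q F A → InFimax p q F B → ∣ A ∣ ≤ ∣ B ∣
  ∣Fnor∣≤∣Fimax∣ (_ , ∣A∣∈S) (_ , _ , max) = max _ ∣A∣∈S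

module ThreeClosed {n r p q : ℕ} {F : Family n} (3≤r : 3 ≤ r) (p<q : p < q)
                   (closed : RClosedThetaIntersecting r p q F) where

  open Ratio p q
  open TorBasics p q F

  0<q : 0 < q
  0<q = ≤-trans (s≤s z≤n) p<q

  ∩-size₂ : ∀ {D E} → F D → F E → D ≢ E →
    ∣ D ∩ E ∣ ≐θ[ p / q ]· ∣ D ∣ ⊎ ∣ D ∩ E ∣ ≐θ[ p / q ]· ∣ E ∣
  ∩-size₂ {D} {E} D∈F E∈F D≢E
    with closed 2 ≤-refl (≤-trans (n≤1+n 2) 3≤r) sets injective members
    where
    sets : Fin 2 → Subset n
    sets zero = D
    sets (suc zero) = E
    injective : ∀ {i j} → sets i ≡ sets j → i ≡ j
    injective {zero} {zero} _ = refl
    injective {zero} {suc zero} e = contradiction e D≢E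
    injective {suc zero} {zero} e = contradiction (sym e) D≢E
    injective {suc zero} {suc zero} _ = refl
    members : ∀ j → F (sets j)
    members zero = D∈F
    members (suc zero) = E∈F
  ... | zero , θ∣D∣ rewrite ∩-identityʳ E = inj₁ θ∣D∣
  ... | suc zero , θ∣E∣ rewrite ∩-identityʳ E = inj₂ θ∣E∣

  ∩-size₃ : ∀ {D E G} → F D → F E → F G → D ≢ E → D ≢ G → E ≢ G →
    ∣ D ∩ (E ∩ G) ∣ ≐θ[ p / q ]· ∣ D ∣ ⊎ ∣ D ∩ (E ∩ G) ∣ ≐θ[ p / q ]· ∣ E ∣
      ⊎ ∣ D ∩ (E ∩ G) ∣ ≐θ[ p / q ]· ∣ G ∣
  ∩-size₃ {D} {E} {G} D∈F E∈F G∈F D≢E D≢G E≢G with closed 3 (n≤1+n 2) 3≤r sets injective members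
    where
    sets : Fin 3 → Subset n
    sets zero = D
    sets (suc zero) = E
    sets (suc (suc zero)) = G
    injective : ∀ {i j} → sets i ≡ sets j → i ≡ j
    injective {zero} {zero} _ = refl
    injective {zero} {suc zero} e = contradiction e D≢E
    injective {zero} {suc (suc zero)} e = contradiction e D≢G
    injective {suc zero} {zero} e = contradiction (sym e) D≢E
    injective {suc zero} {suc zero} _ = refl
    injective {suc zero} {suc (suc zero)} e = contradiction e E≢G
    injective {suc (suc zero)} {zero} e = contradiction (sym e) D≢G
    injective {suc (suc zero)} {suc zero} e = contradiction (sym e) E≢G
    injective {suc (suc zero)} {suc (suc zero)} _ = refl
    members : ∀ j → F (sets j)
    members zero = D∈F
    members (suc zero) = E∈F
    members (suc (suc zero)) = G∈F
  ... | zero , θ∣D∣ rewrite ∩-identityʳ G = inj₁ θ∣D∣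
  ... | suc zero , θ∣E∣ rewrite ∩-identityʳ G = inj₂ (inj₁ θ∣E∣)
  ... | suc (suc zero) , θ∣G∣ rewrite ∩-identityʳ G = inj₂ (inj₂ θ∣G∣)

  InTor-of-equal-size : ∀ {D E} → F D → F E → D ≢ E → ∣ D ∣ ≡ ∣ E ∣ → InTor p q F D E
  InTor-of-equal-size D∈F E∈F D≢E ∣D∣≡∣E∣ with ∩-size₂ D∈F E∈F D≢E
  ... | inj₁ θ∣D∣ = E∈F , ≤-reflexive ∣D∣≡∣E∣ , θ∣D∣
  ... | inj₂ θ∣E∣ = E∈F , ≤-reflexive ∣D∣≡∣E∣ , trans θ∣E∣ (cong (p *_) (sym ∣D∣≡∣E∣))

  core⊆larger : ∀ {D T G} → F D → InTor p q F D T → D ≢ T → F G → D ≢ G → ∣ D ∣ ≤ ∣ G ∣ →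
    core D T ⊆ G
  core⊆larger {D} {T} {G} D∈F (T∈F , ∣D∣≤∣T∣ , θ∣D∣) D≢T G∈F D≢G ∣D∣≤∣G∣ with T ≟ₛ G
  ... | yes refl = p∩q⊆q D T
  ... | no T≢G = ∣p∣≤∣p∩q∣⇒p⊆q (D ∩ T) G
    (subst (λ Z → ∣ D ∩ T ∣ ≤ ∣ Z ∣) (sym (∩-assoc D T G)) core≤∣D∩T∩G∣)
    where
    core≤∣D∩T∩G∣ : ∣ D ∩ T ∣ ≤ ∣ D ∩ (T ∩ G) ∣
    core≤∣D∩T∩G∣ with ∩-size₃ D∈F T∈F G∈F D≢T D≢G T≢G
    ... | inj₁ θ∣D∣' = ≐θ-mono 0<q θ∣D∣ ≤-refl θ∣D∣'
    ... | inj₂ (inj₁ θ∣T∣) = ≐θ-mono 0<q θ∣D∣ ∣D∣≤∣T∣ θ∣T∣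
    ... | inj₂ (inj₂ θ∣G∣) = ≐θ-mono 0<q θ∣D∣ ∣D∣≤∣G∣ θ∣G∣

  core⊆core-of-equal-size : ∀ {B₁ B₂ T₁ T₂} → F B₁ → F B₂ → ∣ B₁ ∣ ≡ ∣ B₂ ∣ →
    InTor p q F B₁ T₁ → B₁ ≢ T₁ → InTor p q F B₂ T₂ → B₂ ≢ T₂ → core B₁ T₁ ⊆ core B₂ T₂
  core⊆core-of-equal-size {B₁} {B₂} {T₁} {T₂} B₁∈F B₂∈F ∣B₁∣≡∣B₂∣ T₁∈Tor B₁≢T₁ T₂∈Tor B₂≢T₂
    with B₁ ≟ₛ B₂
  ... | yes refl = λ x∈core → x∈p∩q⁺ (p∩q⊆p B₁ T₁ x∈core ,
          core⊆larger B₁∈F T₁∈Tor B₁≢T₁ (proj₁ T₂∈Tor) B₂≢T₂ (proj₁ (proj₂ T₂∈Tor)) x∈core)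
  ... | no B₁≢B₂ = λ x∈core →
          x∈p∩q⁺ (core₁⊆B₂ x∈core , core[B₂,B₁]⊆T₂ (x∈p∩q⁺ (core₁⊆B₂ x∈core , p∩q⊆p B₁ T₁ x∈core)))
    where
    core₁⊆B₂ : core B₁ T₁ ⊆ B₂
    core₁⊆B₂ = core⊆larger B₁∈F T₁∈Tor B₁≢T₁ B₂∈F B₁≢B₂ (≤-reflexive ∣B₁∣≡∣B₂∣)
    core[B₂,B₁]⊆T₂ : core B₂ B₁ ⊆ T₂
    core[B₂,B₁]⊆T₂ = core⊆larger B₂∈F
      (InTor-of-equal-size B₂∈F B₁∈F (≢-sym B₁≢B₂) (sym ∣B₁∣≡∣B₂∣)) (≢-sym B₁≢B₂)
      (proj₁ T₂∈Tor) B₂≢T₂ (proj₁ (proj₂ T₂∈Tor))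

  module PetalHit {A B TA TB : Subset n} {x : Fin n}
                  (A∈Fnor : InFnor p q F A) (B∈Fimax : InFimax p q F B)
                  (TA∈Tor : InTor p q F A TA) (TB∈Tor : InTor p q F B TB)
                  (x∈hit : x ∈ petal A TA ∩ core B TB) where

    private
      x∈petal : x ∈ petal A TA
      x∈petal = proj₁ (x∈p∩q⁻ (petal A TA) (core B TB) x∈hit)
      x∈core : x ∈ core B TB
      x∈core = proj₂ (x∈p∩q⁻ (petal A TA) (core B TB) x∈hit)
      A∈F : F A
      A∈F = proj₁ A∈Fnor
      B∈F : F B
      B∈F = proj₁ B∈Fimax
      x∈A : x ∈ A
      x∈A = proj₁ (x∈petal⁻ A TA x∈petal)
      x∉TA : x ∉ TA
      x∉TA = proj₂ (x∈petal⁻ A TA x∈petal)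
      x∈B : x ∈ B
      x∈B = proj₁ (x∈p∩q⁻ B TB x∈core)
      ∣A∣≤∣B∣ : ∣ A ∣ ≤ ∣ B ∣
      ∣A∣≤∣B∣ = ∣Fnor∣≤∣Fimax∣ A∈Fnor B∈Fimax
      ∣A∣≤∣TA∣ : ∣ A ∣ ≤ ∣ TA ∣
      ∣A∣≤∣TA∣ = proj₁ (proj₂ TA∈Tor)
      ∣B∣≤∣TB∣ : ∣ B ∣ ≤ ∣ TB ∣
      ∣B∣≤∣TB∣ = proj₁ (proj₂ TB∈Tor)

      A≢TA : A ≢ TA
      A≢TA A≡TA = x∉TA (subst (x ∈_) A≡TA x∈A)

      -- otherwise x ∈ core A T ⊆ TA
      ¬InTor-through-x : ∀ {T} → x ∈ T → A ≢ T → ¬ InTor p q F A T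
      ¬InTor-through-x x∈T A≢T T∈Tor =
        x∉TA (core⊆larger A∈F T∈Tor A≢T (proj₁ TA∈Tor) A≢TA ∣A∣≤∣TA∣ (x∈p∩q⁺ (x∈A , x∈T)))

    B≢TB : B ≢ TB
    B≢TB = InTor⇒≢ p<q (x , x∈B) TB∈Tor

    ∣A∣<∣B∣ : ∣ A ∣ < ∣ B ∣
    ∣A∣<∣B∣ = ≤∧≢⇒< ∣A∣≤∣B∣ ∣A∣≢∣B∣
      where
      ∣A∣≢∣B∣ : ∣ A ∣ ≢ ∣ B ∣
      ∣A∣≢∣B∣ ∣A∣≡∣B∣ with A ≟ₛ B
      ... | yes refl = ¬InTor-through-x (proj₂ (x∈p∩q⁻ B TB x∈core)) B≢TB TB∈Tor
      ... | no A≢B = ¬InTor-through-x x∈B A≢B (InTor-of-equal-size A∈F B∈F A≢B ∣A∣≡∣B∣)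

    private
      core⊆A-if-θ-of-larger : ∀ {k} → ∣ B ∣ ≤ k → ∣ A ∩ (B ∩ TB) ∣ ≐θ[ p / q ]· k →
        core B TB ⊆ A
      core⊆A-if-θ-of-larger ∣B∣≤k θk = ∣p∣≤∣p∩q∣⇒p⊆q (B ∩ TB) A
        (subst (λ Z → ∣ B ∩ TB ∣ ≤ ∣ Z ∣) (∩-comm A (B ∩ TB))
          (≐θ-mono 0<q (proj₂ (proj₂ TB∈Tor)) ∣B∣≤k θk))

      ¬θ-of-A : A ≢ B → A ≢ TB → ¬ (∣ A ∩ (B ∩ TB) ∣ ≐θ[ p / q ]· ∣ A ∣)
      ¬θ-of-A A≢B A≢TB θ∣A∣ = x∉TA (A∩coreB⊆TA (x∈p∩q⁺ (x∈A , x∈core)))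
        where
        coreA⊆coreB : core A TA ⊆ A ∩ (B ∩ TB)
        coreA⊆coreB x∈coreA = x∈p∩q⁺ (p∩q⊆p A TA x∈coreA , x∈p∩q⁺
          ( core⊆larger A∈F TA∈Tor A≢TA B∈F A≢B ∣A∣≤∣B∣ x∈coreA
          , core⊆larger A∈F TA∈Tor A≢TA (proj₁ TB∈Tor) A≢TB
              (≤-trans ∣A∣≤∣B∣ ∣B∣≤∣TB∣) x∈coreA))
        A∩coreB⊆TA : A ∩ (B ∩ TB) ⊆ TA
        A∩coreB⊆TA = ∣p∣≤∣p∩q∣⇒p⊆q (A ∩ (B ∩ TB)) TA (≤-trans
          (≐θ-mono 0<q θ∣A∣ ≤-refl (proj₂ (proj₂ TA∈Tor)))
          (p⊆q⇒∣p∣≤∣q∣ λ x∈coreA → x∈p∩q⁺ (coreA⊆coreB x∈coreA , p∩q⊆q A TA x∈coreA)))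

    core⊆A : core B TB ⊆ A
    core⊆A with A ≟ₛ B | A ≟ₛ TB
    ... | yes refl | _ = p∩q⊆p A TB
    ... | no _ | yes refl = p∩q⊆q B A
    ... | no A≢B | no A≢TB with ∩-size₃ A∈F B∈F (proj₁ TB∈Tor) A≢B A≢TB B≢TB
    ...   | inj₁ θ∣A∣ = contradiction θ∣A∣ (¬θ-of-A A≢B A≢TB)
    ...   | inj₂ (inj₁ θ∣B∣') = core⊆A-if-θ-of-larger ≤-refl θ∣B∣'
    ...   | inj₂ (inj₂ θ∣TB∣) = core⊆A-if-θ-of-larger ∣B∣≤∣TB∣ θ∣TB∣

  petal-hit-unique : 0 < p → ∀ {A₁ A₂} →
    InFnor p q F A₁ → HasPetalHit p q F A₁ → InFnor p q F A₂ → HasPetalHit p q F A₂ → A₁ ≡ A₂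
  petal-hit-unique 0<p {A₁} {A₂}
    A₁∈Fnor (B₁ , B₁∈Fimax , TA₁ , TB₁ , TA₁∈Tor , TB₁∈Tor , _ , x₁∈hit)
    A₂∈Fnor (B₂ , B₂∈Fimax , TA₂ , TB₂ , TA₂∈Tor , TB₂∈Tor , _ , x₂∈hit) with A₁ ≟ₛ A₂
  ... | yes A₁≡A₂ = A₁≡A₂
  ... | no A₁≢A₂ = contradiction (p⊆q⇒∣p∣≤∣q∣ core₁⊆A₁∩A₂) (<⇒≱ ∣A₁∩A₂∣<∣core₁∣)
    where
    module H₁ = PetalHit A₁∈Fnor B₁∈Fimax TA₁∈Tor TB₁∈Tor x₁∈hit
    module H₂ = PetalHit A₂∈Fnor B₂∈Fimax TA₂∈Tor TB₂∈Tor x₂∈hit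
    ∣B₁∣≡∣B₂∣ : ∣ B₁ ∣ ≡ ∣ B₂ ∣
    ∣B₁∣≡∣B₂∣ = IsImax-unique (proj₂ B₁∈Fimax) (proj₂ B₂∈Fimax)
    core₁⊆A₁∩A₂ : core B₁ TB₁ ⊆ A₁ ∩ A₂
    core₁⊆A₁∩A₂ x∈core₁ = x∈p∩q⁺ (H₁.core⊆A x∈core₁ , H₂.core⊆A
      (core⊆core-of-equal-size (proj₁ B₁∈Fimax) (proj₁ B₂∈Fimax) ∣B₁∣≡∣B₂∣
         TB₁∈Tor H₁.B≢TB TB₂∈Tor H₂.B≢TB x∈core₁))
    ∣A₁∩A₂∣<∣core₁∣ : ∣ A₁ ∩ A₂ ∣ < ∣ core B₁ TB₁ ∣
    ∣A₁∩A₂∣<∣core₁∣ with ∩-size₂ (proj₁ A₁∈Fnor) (proj₁ A₂∈Fnor) A₁≢A₂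
    ... | inj₁ θ∣A₁∣ = ≐θ-strictMono 0<p θ∣A₁∣ H₁.∣A∣<∣B∣ (proj₂ (proj₂ TB₁∈Tor))
    ... | inj₂ θ∣A₂∣ = ≐θ-strictMono 0<p θ∣A₂∣
      (subst (∣ A₂ ∣ <_) (sym ∣B₁∣≡∣B₂∣) H₂.∣A∣<∣B∣) (proj₂ (proj₂ TB₁∈Tor))

lemma2p14 : ∀ (n r p q : ℕ) (F : Family n) →
    3 ≤ r → 0 < p → p < q →
    RClosedThetaIntersecting r p q F →
    (∀ (A B TA TB : Subset n) →
      InFnor p q F A → InFimax p q F B →
      InTor p q F A TA → InTor p q F B TB →
      Nonempty (petal A TA ∩ core B TB) → core B TB ⊆ A)
    ×
    (∀ (A₁ A₂ : Subset n) →
      InFnor p q F A₁ → HasPetalHit p q F A₁ →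
      InFnor p q F A₂ → HasPetalHit p q F A₂ → A₁ ≡ A₂)
lemma2p14 n r p q F 3≤r 0<p p<q closed =
  (λ A B TA TB A∈Fnor B∈Fimax TA∈Tor TB∈Tor (_ , x∈hit) →
     PetalHit.core⊆A A∈Fnor B∈Fimax TA∈Tor TB∈Tor x∈hit) ,
  (λ A₁ A₂ → petal-hit-unique 0<p)
  where open ThreeClosed {F = F} 3≤r p<q closed
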